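{- Let $n > 0$. Consider the following random procedure: draw an integer $p$ with $\mathbb{P}[p = j] \propto \frac{1}{j!}$ for $0 \le j \le n$ (a Poisson variable of parameter $1$ conditioned to be at most $n$); form the array $A$ of length $n$ consisting of $p$ zeros followed by $1, 2, \dots, n-p$; then for $i = 0$ to $n-2$, draw $r$ uniformly in $\{i, \dots, n-1\}$ and swap $A[r]$ and $A[i]$ (Fisher–Yates shuffle, with independent draws). The resulting array $A$ is a uniformly random variation of size $n$.
   Context: A variation of size $n$ is a sequence of $n$ non-negative integers such that each strictly positive integer appears at most once, and if $0 < i < j$ and $j$ appears in the sequence then $i$ appears too. -}

module Defs where

open import Data.Nat as ℕ using (ℕ; zero; suc; _∸_; _<_; _!)
open import Data.Nat.Properties using (_!≢0)
open import Data.Nat.DivMod using () renaming (_/_ to _div_)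
open import Data.Integer using (+_)
open import Data.Rational as ℚ using (ℚ; 0ℚ; _+_; _*_; _/_)
open import Data.List using (List; []; _∷_; length; map; concatMap; upTo; drop; replicate; _++_; foldr; lookup)
open import Data.List.Membership.Propositional using (_∈_)
open import Data.List.Properties using (≡-dec)
open import Data.Fin using (Fin)
open import Data.Product using (_×_; _,_)
open import Relation.Binary.PropositionalEquality using (_≡_)
open import Relation.Nullary using (yes; no)

IsVariation : ℕ → List ℕ → Set
IsVariation n v =
  (length v ≡ n)
  × (∀ (a b : Fin (length v)) → lookup v a ≡ lookup v b → 0 < lookup v a → a ≡ b)
  × (∀ (i j : ℕ) → 0 < i → i < j → j ∈ v → i ∈ v)

Dist : Set → Set
Dist A = List (A × ℚ)

return : ∀ {A} → A → Dist A
return a = (a , ℚ.1ℚ) ∷ []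

_>>=_ : ∀ {A B} → Dist A → (A → Dist B) → Dist B
d >>= f = concatMap (λ { (a , p) → map (λ { (b , q) → (b , p * q) }) (f a) }) d

uniform : ∀ {A} → List A → Dist A
uniform [] = []
uniform (x ∷ xs) = map (λ y → (y , (+ 1) / suc (length xs))) (x ∷ xs)

mass : ∀ {A} → Dist A → ℚ
mass = foldr (λ { (_ , p) s → p + s }) 0ℚ

prob : Dist (List ℕ) → List ℕ → ℚ
prob [] v = 0ℚ
prob ((w , p) ∷ d) v with ≡-dec ℕ._≟_ w v
... | yes _ = p + prob d v
... | no  _ = prob d v

-- unnormalised weight n!/j! of p = j (proportional to 1/j!)
weight : ℕ → ℕ → ℕ
weight n j = _div_ (n !) (j !) {{j !≢0}}

-- normalising constant  Σ_{j=0}^{n} n!/j!, with the j = n term (= 1)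
-- written out separately so that it is visibly nonzero
normC : ℕ → ℕ
normC n = suc (foldr ℕ._+_ 0 (map (weight n) (upTo n)))

poissonTrunc : ℕ → Dist ℕ
poissonTrunc n = map (λ j → (j , (+ weight n j) / normC n)) (upTo (suc n))

initial : ℕ → ℕ → List ℕ
initial n p = replicate p 0 ++ map suc (upTo (n ∸ p))

at : List ℕ → ℕ → ℕ
at [] _ = 0
at (x ∷ xs) zero = x
at (x ∷ xs) (suc i) = at xs i

setAt : ℕ → ℕ → List ℕ → List ℕ
setAt _ _ [] = []
setAt zero a (x ∷ xs) = a ∷ xs
setAt (suc i) a (x ∷ xs) = x ∷ setAt i a xs

swap : ℕ → ℕ → List ℕ → List ℕ
swap i r A = setAt r (at A i) (setAt i (at A r) A)

fisherYates : ℕ → List ℕ → List ℕ → Dist (List ℕ)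
fisherYates n [] A = return A
fisherYates n (i ∷ is) A =
  uniform (drop i (upTo n)) >>= λ r → fisherYates n is (swap i r A)

procedure : ℕ → Dist (List ℕ)
procedure n = poissonTrunc n >>= λ p → fisherYates n (upTo (n ∸ 1)) (initial n p)

{-# OPTIONS --safe #-}
-- Every swap permutes the array, so each outcome of the shuffle started from p zeros followed
-- by 1, …, n − p has the same entries with the same multiplicities: it is a variation with exactly
-- p zeros, and every variation with z zeros arises in this way from p = z. For an array with z
-- zeros and distinct positive entries, the shuffle produces a given rearrangement with probability
-- z!/n!: the first draw has to bring the right entry to the front, which happens for z of the n
-- positions if that entry is 0 (leaving z − 1 zeros) and for exactly one position otherwise, and
-- the remaining draws shuffle the rest. Since P[p = z] is proportional to n!/z!, every variation
-- is produced with the same probability.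

module Submission where

open import Defs
open import Data.Nat as ℕ
  using (ℕ; zero; suc; pred; _+_; _*_; _∸_; _≤_; _<_; _≟_; _≤?_; _<?_; z≤n; s≤s; _!)
open import Data.Nat.Properties
open import Data.Nat.Divisibility using (m≤n⇒m!∣n!)
open import Data.Nat.DivMod using (m/n*n≡m; n/n≡1)
open import Data.Nat.ListAction using (sum)
open import Data.Nat.ListAction.Properties using (sum-++)
open import Data.Nat.Tactic.RingSolver using (solve-∀)
import Data.Integer as ℤ
import Data.Integer.Properties as ℤ
open import Data.Rational as ℚ using (ℚ; 0ℚ; 1ℚ; toℚᵘ)
import Data.Rational.Properties as ℚ
open import Data.Rational.Unnormalised as ℚᵘ using (mkℚᵘ; *≡*)
import Data.Rational.Unnormalised.Properties as ℚᵘ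
open import Data.List
  using (List; []; _∷_; [_]; length; map; upTo; applyUpTo; drop; replicate; _++_; lookup)
open import Data.List.Properties
  using ( ≡-dec; length-++; length-map; length-replicate; length-applyUpTo; map-++; map-∘; map-upTo
        ; upTo-∷ʳ; ++-assoc; ++-cancelˡ; ∷-injectiveˡ)
open import Data.List.Relation.Unary.All as All using (All; []; _∷_)
import Data.List.Relation.Unary.All.Properties as All
open import Data.List.Relation.Unary.Any as Any using (here; there)
open import Data.List.Relation.Unary.Any.Properties using (lookup-index)
open import Data.List.Membership.Propositional using (_∈_; _∉_)
open import Data.List.Membership.Propositional.Properties using (∈-upTo⁻; ∈-applyUpTo⁻; ∈-lookup)
open import Data.List.Membership.DecPropositional _≟_ using (_∈?_)
open import Data.Fin as Fin using (Fin)
import Data.Fin.Properties as Fin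
open import Data.Product using (_×_; _,_; proj₁; proj₂; ∃)
open import Function using (_∘_)
open import Relation.Binary.PropositionalEquality hiding ([_])
open import Relation.Nullary using (¬_; yes; no; contradiction)

-- Occurrence counts

δ : ℕ → ℕ → ℕ
δ x y with x ≟ y
... | yes _ = 1
... | no  _ = 0

δ-refl : ∀ x → δ x x ≡ 1
δ-refl x with x ≟ x
... | yes _  = refl
... | no x≢x = contradiction refl x≢x

δ-≢ : ∀ {x y} → x ≢ y → δ x y ≡ 0
δ-≢ {x} {y} x≢y with x ≟ y
... | yes x≡y = contradiction x≡y x≢y
... | no  _   = refl

δ≤1 : ∀ x y → δ x y ≤ 1
δ≤1 x y with x ≟ y
... | yes _ = s≤s z≤n
... | no  _ = z≤n

δ-suc : ∀ x y → δ (suc x) (suc y) ≡ δ x y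
δ-suc x y with x ≟ y
... | yes refl = δ-refl (suc x)
... | no  x≢y  = δ-≢ (x≢y ∘ suc-injective)

occ : ℕ → List ℕ → ℕ
occ x []      = 0
occ x (y ∷ L) = δ x y + occ x L

occ-++ : ∀ x A B → occ x (A ++ B) ≡ occ x A + occ x B
occ-++ x []      B = refl
occ-++ x (y ∷ A) B = trans (cong (δ x y +_) (occ-++ x A B)) (sym (+-assoc (δ x y) _ _))

occ-0-replicate : ∀ p → occ 0 (replicate p 0) ≡ p
occ-0-replicate zero    = refl
occ-0-replicate (suc p) = cong suc (occ-0-replicate p)

occ-suc-replicate : ∀ y p → occ (suc y) (replicate p 0) ≡ 0
occ-suc-replicate y zero    = refl
occ-suc-replicate y (suc p) = occ-suc-replicate y p

occ-0-map-suc : ∀ L → occ 0 (map suc L) ≡ 0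
occ-0-map-suc []      = refl
occ-0-map-suc (x ∷ L) = occ-0-map-suc L

occ-suc-map-suc : ∀ y L → occ (suc y) (map suc L) ≡ occ y L
occ-suc-map-suc y []      = refl
occ-suc-map-suc y (x ∷ L) = cong₂ _+_ (δ-suc y x) (occ-suc-map-suc y L)

occ≤length : ∀ x L → occ x L ≤ length L
occ≤length x []      = z≤n
occ≤length x (y ∷ L) = +-mono-≤ (δ≤1 x y) (occ≤length x L)

∈⇒0<occ : ∀ {x L} → x ∈ L → 0 < occ x L
∈⇒0<occ {x} (here refl) = ≤-trans (≤-reflexive (sym (δ-refl x))) (m≤m+n _ _)
∈⇒0<occ {x} {y ∷ _} (there x∈L) = ≤-trans (∈⇒0<occ x∈L) (m≤n+m _ (δ x y))

0<occ⇒∈ : ∀ {x} L → 0 < occ x L → x ∈ L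
0<occ⇒∈ {x} (y ∷ L) 0<occ with x ≟ y
... | yes x≡y = here x≡y
... | no  _   = there (0<occ⇒∈ L 0<occ)

∉⇒occ≡0 : ∀ {x} L → x ∉ L → occ x L ≡ 0
∉⇒occ≡0 {x} L x∉L with occ x L in eq
... | zero  = refl
... | suc _ = contradiction (0<occ⇒∈ L (subst (0 <_) (sym eq) (s≤s z≤n))) x∉L

infix 4 _~_

_~_ : List ℕ → List ℕ → Set
A ~ B = ∀ x → occ x A ≡ occ x B

~-∷-cancel : ∀ {y A B} → (y ∷ A) ~ (y ∷ B) → A ~ B
~-∷-cancel {y} A~B x = +-cancelˡ-≡ (δ x y) _ _ (A~B x)

∈-~ : ∀ {x A} B → A ~ B → x ∈ A → x ∈ B
∈-~ {x} B A~B x∈A = 0<occ⇒∈ B (subst (0 <_) (A~B x) (∈⇒0<occ x∈A))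

UniquePositives : List ℕ → Set
UniquePositives L = ∀ x → 0 < x → occ x L ≤ 1

uniquePositives-~ : ∀ {A B} → A ~ B → UniquePositives B → UniquePositives A
uniquePositives-~ A~B uB x 0<x = ≤-trans (≤-reflexive (A~B x)) (uB x 0<x)

uniquePositives-∷⁻ : ∀ {y L} → UniquePositives (y ∷ L) → UniquePositives L
uniquePositives-∷⁻ {y} u x 0<x = ≤-trans (m≤n+m _ (δ x y)) (u x 0<x)

occ≡1 : ∀ {x L} → UniquePositives L → 0 < x → x ∈ L → occ x L ≡ 1
occ≡1 {x} u 0<x x∈L = ≤-antisym (u x 0<x) (∈⇒0<occ x∈L)

-- Index lists and swaps

range : ℕ → ℕ → List ℕ
range k zero    = []
range k (suc m) = k ∷ range (suc k) m

applyUpTo-range : ∀ (f : ℕ → ℕ) k m → (∀ x → f x ≡ k + x) → applyUpTo f m ≡ range k m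
applyUpTo-range f k zero    f≗k+ = refl
applyUpTo-range f k (suc m) f≗k+ = cong₂ _∷_ (trans (f≗k+ 0) (+-identityʳ k))
  (applyUpTo-range (f ∘ suc) (suc k) m (λ x → trans (f≗k+ (suc x)) (+-suc k x)))

upTo≡range : ∀ m → upTo m ≡ range 0 m
upTo≡range m = applyUpTo-range (λ x → x) 0 m (λ _ → refl)

range-≥ : ∀ k m → All (k ≤_) (range k m)
range-≥ k zero    = []
range-≥ k (suc m) = ≤-refl ∷ All.map (≤-trans (n≤1+n k)) (range-≥ (suc k) m)

occ-range-< : ∀ y k m → y < k → occ y (range k m) ≡ 0
occ-range-< y k zero    y<k = refl
occ-range-< y k (suc m) y<k =
  cong₂ _+_ (δ-≢ (<⇒≢ y<k)) (occ-range-< y (suc k) m (m<n⇒m<1+n y<k))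

occ-range-≥ : ∀ y k m → k + m ≤ y → occ y (range k m) ≡ 0
occ-range-≥ y k zero    _     = refl
occ-range-≥ y k (suc m) k+1+m≤y = cong₂ _+_ (δ-≢ (>⇒≢ k<y)) (occ-range-≥ y (suc k) m 1+k+m≤y)
  where
  1+k+m≤y : suc k + m ≤ y
  1+k+m≤y = subst (_≤ y) (+-suc k m) k+1+m≤y
  k<y : k < y
  k<y = <-≤-trans (s≤s (m≤m+n k m)) 1+k+m≤y

occ-range-∈ : ∀ y k m → k ≤ y → y < k + m → occ y (range k m) ≡ 1
occ-range-∈ y k zero    k≤y y<k+0 = contradiction k≤y (<⇒≱ (<-≤-trans y<k+0 (≤-reflexive (+-identityʳ k))))
occ-range-∈ y k (suc m) k≤y y<k+m with y ≟ k
... | yes refl = cong suc (occ-range-< y (suc y) m ≤-refl)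
... | no  y≢k  = occ-range-∈ y (suc k) m (≤∧≢⇒< k≤y (y≢k ∘ sym)) (<-≤-trans y<k+m (≤-reflexive (+-suc k m)))

occ-upTo-< : ∀ {y m} → y < m → occ y (upTo m) ≡ 1
occ-upTo-< {y} {m} y<m = trans (cong (occ y) (upTo≡range m)) (occ-range-∈ y 0 m z≤n y<m)

occ-upTo-≥ : ∀ {y m} → m ≤ y → occ y (upTo m) ≡ 0
occ-upTo-≥ {y} {m} m≤y = trans (cong (occ y) (upTo≡range m)) (occ-range-≥ y 0 m m≤y)

occ-upTo≤1 : ∀ y m → occ y (upTo m) ≤ 1
occ-upTo≤1 y m with y <? m
... | yes y<m = ≤-reflexive (occ-upTo-< y<m)
... | no  y≮m = ≤-trans (≤-reflexive (occ-upTo-≥ (≮⇒≥ y≮m))) z≤n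

drop-applyUpTo : ∀ (f : ℕ → ℕ) k m → drop k (applyUpTo f (k + m)) ≡ applyUpTo (f ∘ (k +_)) m
drop-applyUpTo f zero    m = refl
drop-applyUpTo f (suc k) m = drop-applyUpTo (f ∘ suc) k m

drop-upTo : ∀ k m → drop k (upTo (k + m)) ≡ map (k +_) (upTo m)
drop-upTo k m = trans (drop-applyUpTo (λ x → x) k m) (sym (map-upTo (k +_) m))

∈-drop-applyUpTo : ∀ (f : ℕ → ℕ) {r} i n → r ∈ drop i (applyUpTo f n) → ∃ λ x → i ≤ x × x < n × r ≡ f x
∈-drop-applyUpTo f zero n r∈ with ∈-applyUpTo⁻ f r∈
... | x , x<n , refl = x , z≤n , x<n , refl
∈-drop-applyUpTo f (suc i) (suc n) r∈ with ∈-drop-applyUpTo (f ∘ suc) i n r∈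
... | x , i≤x , x<n , refl = suc x , s≤s i≤x , s≤s x<n , refl

∈-drop-upTo : ∀ {r} i n → r ∈ drop i (upTo n) → i ≤ r × r < n
∈-drop-upTo i n r∈ with ∈-drop-applyUpTo (λ x → x) i n r∈
... | _ , i≤r , r<n , refl = i≤r , r<n


length-setAt : ∀ i a L → length (setAt i a L) ≡ length L
length-setAt i       a []      = refl
length-setAt zero    a (x ∷ L) = refl
length-setAt (suc i) a (x ∷ L) = cong suc (length-setAt i a L)

at-setAt-≡ : ∀ i a L → i < length L → at (setAt i a L) i ≡ a
at-setAt-≡ zero    a (x ∷ L) _         = refl
at-setAt-≡ (suc i) a (x ∷ L) (s≤s i<) = at-setAt-≡ i a L i<

at-setAt-≢ : ∀ i j a L → i ≢ j → at (setAt i a L) j ≡ at L j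
at-setAt-≢ i       j       a []      _   = refl
at-setAt-≢ zero    zero    a (x ∷ L) i≢j = contradiction refl i≢j
at-setAt-≢ zero    (suc j) a (x ∷ L) _   = refl
at-setAt-≢ (suc i) zero    a (x ∷ L) _   = refl
at-setAt-≢ (suc i) (suc j) a (x ∷ L) i≢j = at-setAt-≢ i j a L (i≢j ∘ cong suc)

-- Stated with the overwritten entry on the left, so that no truncated subtraction occurs.
occ-setAt : ∀ x i a L → i < length L → occ x (setAt i a L) + δ x (at L i) ≡ occ x L + δ x a
occ-setAt x zero    a (y ∷ L) _        = a+b+c≡c+b+a (δ x a) (occ x L) (δ x y)
  where
  a+b+c≡c+b+a : ∀ a b c → a + b + c ≡ c + b + a
  a+b+c≡c+b+a = solve-∀
occ-setAt x (suc i) a (y ∷ L) (s≤s i<) = begin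
  δ x y + occ x (setAt i a L) + δ x (at L i)   ≡⟨ +-assoc (δ x y) _ _ ⟩
  δ x y + (occ x (setAt i a L) + δ x (at L i)) ≡⟨ cong (δ x y +_) (occ-setAt x i a L i<) ⟩
  δ x y + (occ x L + δ x a)                    ≡⟨ +-assoc (δ x y) _ _ ⟨
  δ x y + occ x L + δ x a                      ∎
  where open ≡-Reasoning

length-swap : ∀ i r L → length (swap i r L) ≡ length L
length-swap i r L = trans (length-setAt r (at L i) (setAt i (at L r) L)) (length-setAt i (at L r) L)

swap-~ : ∀ i r L → i < length L → r < length L → swap i r L ~ L
swap-~ i r L i< r< x = +-cancelʳ-≡ _ _ _ (begin
  occ x (swap i r L) + δ x (at L r)  ≡⟨ cong (λ a → occ x (swap i r L) + δ x a) at-L₁-r ⟨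
  occ x (swap i r L) + δ x (at L₁ r) ≡⟨ occ-setAt x r (at L i) L₁ (subst (r <_) (sym (length-setAt i _ L)) r<) ⟩
  occ x L₁ + δ x (at L i)            ≡⟨ occ-setAt x i (at L r) L i< ⟩
  occ x L + δ x (at L r)             ∎)
  where
  open ≡-Reasoning
  L₁ : List ℕ
  L₁ = setAt i (at L r) L
  at-L₁-r : at L₁ r ≡ at L r
  at-L₁-r with i ≟ r
  ... | yes refl = at-setAt-≡ i _ L i<
  ... | no  i≢r  = at-setAt-≢ i r _ L i≢r

swap-++ : ∀ P i r A → swap (length P + i) (length P + r) (P ++ A) ≡ P ++ swap i r A
swap-++ []      i r A = refl
swap-++ (p ∷ P) i r A = cong (p ∷_) (swap-++ P i r A)

swap-++-≥ : ∀ P {i r} A → length P ≤ i → length P ≤ r →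
  swap i r (P ++ A) ≡ P ++ swap (i ∸ length P) (r ∸ length P) A
swap-++-≥ P {i} {r} A P≤i P≤r = trans
  (cong₂ (λ i r → swap i r (P ++ A)) (sym (m+[n∸m]≡n P≤i)) (sym (m+[n∸m]≡n P≤r)))
  (swap-++ P (i ∸ length P) (r ∸ length P) A)

swap-head : ∀ r s S → swap 0 r (s ∷ S) ≡ at (s ∷ S) r ∷ drop 1 (swap 0 r (s ∷ S))
swap-head zero    s S = refl
swap-head (suc r) s S = refl

length-++-[] : ∀ P {y : ℕ} → length (P ++ [ y ]) ≡ suc (length P)
length-++-[] P = trans (length-++ P) (+-comm (length P) 1)

swap-into-prefix : ∀ P r s S → r < suc (length S) → ∃ λ R →
  swap (length P) (length P + r) (P ++ s ∷ S) ≡ (P ++ [ at (s ∷ S) r ]) ++ R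
  × length R ≡ length S × at (s ∷ S) r ∷ R ~ s ∷ S
swap-into-prefix P r s S r< = R , swapped , length-R , counts
  where
  R : List ℕ
  R = drop 1 (swap 0 r (s ∷ S))
  swapped : swap (length P) (length P + r) (P ++ s ∷ S) ≡ (P ++ [ at (s ∷ S) r ]) ++ R
  swapped = begin
    swap (length P) (length P + r) (P ++ s ∷ S)          ≡⟨ cong (λ i → swap i (length P + r) (P ++ s ∷ S)) (+-identityʳ _) ⟨
    swap (length P + 0) (length P + r) (P ++ s ∷ S)      ≡⟨ swap-++ P 0 r (s ∷ S) ⟩
    P ++ swap 0 r (s ∷ S)                                ≡⟨ cong (P ++_) (swap-head r s S) ⟩
    P ++ at (s ∷ S) r ∷ drop 1 (swap 0 r (s ∷ S))        ≡⟨ ++-assoc P _ _ ⟨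
    (P ++ [ at (s ∷ S) r ]) ++ drop 1 (swap 0 r (s ∷ S)) ∎
    where open ≡-Reasoning
  length-R : length R ≡ length S
  length-R = suc-injective (trans (cong length (sym (swap-head r s S))) (length-swap 0 r (s ∷ S)))
  counts : at (s ∷ S) r ∷ R ~ s ∷ S
  counts x = trans (cong (occ x) (sym (swap-head r s S))) (swap-~ 0 r (s ∷ S) (s≤s z≤n) r< x)

applyUpTo-at : ∀ S → applyUpTo (at S) (length S) ≡ S
applyUpTo-at []      = refl
applyUpTo-at (s ∷ S) = cong (s ∷_) (applyUpTo-at S)

-- Fractions a/(1+b)

-- Every weight in uniform and poissonTrunc is definitionally of this form.
infix 7.5 _/1+_

_/1+_ : ℕ → ℕ → ℚ
a /1+ b = ℤ.+ a ℚ./ suc b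

private
  toℚᵘ-/1+ : ∀ a b → toℚᵘ (a /1+ b) ℚᵘ.≃ mkℚᵘ (ℤ.+ a) b
  toℚᵘ-/1+ a b = ℚ.toℚᵘ-fromℚᵘ (mkℚᵘ (ℤ.+ a) b)

  +-mkℚᵘ : ∀ a c b → mkℚᵘ (ℤ.+ a) b ℚᵘ.+ mkℚᵘ (ℤ.+ c) b ℚᵘ.≃ mkℚᵘ (ℤ.+ (a + c)) b
  +-mkℚᵘ a c b = *≡* (begin
    (ℤ.+ a ℤ.* ℤ.+ suc b ℤ.+ ℤ.+ c ℤ.* ℤ.+ suc b) ℤ.* ℤ.+ suc b
      ≡⟨ cong₂ (λ x y → (x ℤ.+ y) ℤ.* ℤ.+ suc b) (ℤ.pos-* a (suc b)) (ℤ.pos-* c (suc b)) ⟨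
    ℤ.+ (a * suc b + c * suc b) ℤ.* ℤ.+ suc b
      ≡⟨ ℤ.pos-* (a * suc b + c * suc b) (suc b) ⟨
    ℤ.+ ((a * suc b + c * suc b) * suc b)
      ≡⟨ cong ℤ.+_ (distrib a c (suc b)) ⟩
    ℤ.+ ((a + c) * (suc b * suc b))
      ≡⟨ ℤ.pos-* (a + c) (suc b * suc b) ⟩
    ℤ.+ (a + c) ℤ.* ℤ.+ (suc b * suc b) ∎)
    where
    open ≡-Reasoning
    distrib : ∀ a c s → (a * s + c * s) * s ≡ (a + c) * (s * s)
    distrib = solve-∀

  *-mkℚᵘ : ∀ a b c d → mkℚᵘ (ℤ.+ a) b ℚᵘ.* mkℚᵘ (ℤ.+ c) d ℚᵘ.≃ mkℚᵘ (ℤ.+ (a * c)) (d + b * suc d)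
  *-mkℚᵘ a b c d = *≡* (cong (ℤ._* ℤ.+ suc (d + b * suc d)) (sym (ℤ.pos-* a c)))

/1+-cross : ∀ {a b c d} → a * suc d ≡ c * suc b → a /1+ b ≡ c /1+ d
/1+-cross {a} {b} {c} {d} eq = ℚ.fromℚᵘ-cong {mkℚᵘ (ℤ.+ a) b} {mkℚᵘ (ℤ.+ c) d}
  (*≡* (trans (sym (ℤ.pos-* a (suc d))) (trans (cong ℤ.+_ eq) (ℤ.pos-* c (suc b)))))

+-/1+ : ∀ a c b → a /1+ b ℚ.+ c /1+ b ≡ (a + c) /1+ b
+-/1+ a c b = ℚ.toℚᵘ-injective (ℚᵘ.≃-trans (ℚ.toℚᵘ-homo-+ (a /1+ b) (c /1+ b))
  (ℚᵘ.≃-trans (ℚᵘ.+-cong (toℚᵘ-/1+ a b) (toℚᵘ-/1+ c b))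
  (ℚᵘ.≃-trans (+-mkℚᵘ a c b) (ℚᵘ.≃-sym (toℚᵘ-/1+ (a + c) b)))))

*-/1+ : ∀ a b c d → a /1+ b ℚ.* c /1+ d ≡ (a * c) /1+ (d + b * suc d)
*-/1+ a b c d = ℚ.toℚᵘ-injective (ℚᵘ.≃-trans (ℚ.toℚᵘ-homo-* (a /1+ b) (c /1+ d))
  (ℚᵘ.≃-trans (ℚᵘ.*-cong (toℚᵘ-/1+ a b) (toℚᵘ-/1+ c d))
  (ℚᵘ.≃-trans (*-mkℚᵘ a b c d) (ℚᵘ.≃-sym (toℚᵘ-/1+ (a * c) (d + b * suc d))))))

0/1+b≡0 : ∀ b → 0 /1+ b ≡ 0ℚ
0/1+b≡0 b = ℚ.0/n≡0 (suc b)

1+b/1+b≡1 : ∀ b → suc b /1+ b ≡ 1ℚ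
1+b/1+b≡1 b = /1+-cross {suc b} {b} {1} {0} (trans (*-identityʳ (suc b)) (sym (+-identityʳ (suc b))))

*-≡0ʳ : ∀ p {q} → q ≡ 0ℚ → p ℚ.* q ≡ 0ℚ
*-≡0ʳ p refl = ℚ.*-zeroʳ p

1/1+-*-/1+ : ∀ m a {D′ D} → suc D ≡ suc m * suc D′ → 1 /1+ m ℚ.* a /1+ D′ ≡ a /1+ D
1/1+-*-/1+ m a {D′} D≡ = trans (*-/1+ 1 m a D′) (cong₂ _/1+_ (*-identityˡ a) (suc-injective (sym D≡)))

/1+-*-/1+-cancel : ∀ a b c D → a * c ≡ suc D → a /1+ b ℚ.* c /1+ D ≡ 1 /1+ b
/1+-*-/1+-cancel a b c D ac≡1+D = trans (*-/1+ a b c D)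
  (/1+-cross {a * c} {D + b * suc D} {1} {b} (trans (cong (_* suc b) ac≡1+D) (identity D b)))
  where
  identity : ∀ D b → suc D * suc b ≡ 1 * suc (D + b * suc D)
  identity = solve-∀

-- Finite distributions

sumℚ : ∀ {A : Set} → List A → (A → ℚ) → ℚ
sumℚ []      f = 0ℚ
sumℚ (x ∷ L) f = f x ℚ.+ sumℚ L f

sumℚ-cong : ∀ {A : Set} {f g : A → ℚ} L → All (λ y → f y ≡ g y) L → sumℚ L f ≡ sumℚ L g
sumℚ-cong []      []           = refl
sumℚ-cong (x ∷ L) (fx≡gx ∷ eqs) = cong₂ ℚ._+_ fx≡gx (sumℚ-cong L eqs)

sumℚ-0 : ∀ {A : Set} {f : A → ℚ} L → All (λ y → f y ≡ 0ℚ) L → sumℚ L f ≡ 0ℚ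
sumℚ-0 []      []           = refl
sumℚ-0 (x ∷ L) (fx≡0 ∷ eqs) = trans (cong₂ ℚ._+_ fx≡0 (sumℚ-0 L eqs)) (ℚ.+-identityˡ 0ℚ)

sumℚ-map : ∀ {A B : Set} (h : A → B) (f : B → ℚ) L → sumℚ (map h L) f ≡ sumℚ L (f ∘ h)
sumℚ-map h f []      = refl
sumℚ-map h f (x ∷ L) = cong (f (h x) ℚ.+_) (sumℚ-map h f L)

sumℚ-/1+ : ∀ {A : Set} (h : A → ℕ) b L → sumℚ L (λ y → h y /1+ b) ≡ sum (map h L) /1+ b
sumℚ-/1+ h b []      = sym (0/1+b≡0 b)
sumℚ-/1+ h b (x ∷ L) = trans (cong (h x /1+ b ℚ.+_) (sumℚ-/1+ h b L)) (+-/1+ (h x) _ b)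

sumℚ-single : ∀ {f : ℕ → ℚ} {z} L → occ z L ≡ 1 → All (λ j → j ≢ z → f j ≡ 0ℚ) L → sumℚ L f ≡ f z
sumℚ-single {f} {z} (x ∷ L) occ≡1 (fx≡0 ∷ f≡0) with z ≟ x
... | yes refl = trans (cong (f z ℚ.+_) (sumℚ-0 L (All.tabulate λ j∈L → All.lookup f≡0 j∈L (≢z j∈L))))
                       (ℚ.+-identityʳ (f z))
  where
  occ≡0 : occ z L ≡ 0
  occ≡0 = suc-injective occ≡1
  ≢z : ∀ {j} → j ∈ L → j ≢ z
  ≢z j∈L refl = contradiction (subst (0 <_) occ≡0 (∈⇒0<occ j∈L)) λ ()
... | no  z≢x  = trans (cong (ℚ._+ sumℚ L f) (fx≡0 (z≢x ∘ sym)))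
                       (trans (ℚ.+-identityˡ _) (sumℚ-single L occ≡1 f≡0))

expect : ∀ {A : Set} → Dist A → (A → ℚ) → ℚ
expect []            g = 0ℚ
expect ((a , p) ∷ d) g = p ℚ.* g a ℚ.+ expect d g

expect-cong : ∀ {A : Set} {g h : A → ℚ} d → (∀ a → g a ≡ h a) → expect d g ≡ expect d h
expect-cong []            g≗h = refl
expect-cong ((a , p) ∷ d) g≗h = cong₂ (λ x y → p ℚ.* x ℚ.+ y) (g≗h a) (expect-cong d g≗h)

expect-1 : ∀ {A : Set} (d : Dist A) → expect d (λ _ → 1ℚ) ≡ mass d
expect-1 []            = refl
expect-1 ((a , p) ∷ d) = cong₂ ℚ._+_ (ℚ.*-identityʳ p) (expect-1 d)

expect-weighted : ∀ {A : Set} (c g : A → ℚ) L → expect (map (λ y → (y , c y)) L) g ≡ sumℚ L (λ y → c y ℚ.* g y)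
expect-weighted c g []      = refl
expect-weighted c g (x ∷ L) = cong (c x ℚ.* g x ℚ.+_) (expect-weighted c g L)

mass-weighted : ∀ {A : Set} (c : A → ℚ) L → mass (map (λ y → (y , c y)) L) ≡ sumℚ L c
mass-weighted c []      = refl
mass-weighted c (x ∷ L) = cong (c x ℚ.+_) (mass-weighted c L)

-- _>>=_ rescales the inner distributions by a pattern lambda, which can only be referred to
-- through its action on pairs.
Scales : ∀ {B : Set} → ℚ → (B × ℚ → B × ℚ) → Set
Scales p h = ∀ b q → h (b , q) ≡ (b , p ℚ.* q)

prob-++ : ∀ d e v → prob (d ++ e) v ≡ prob d v ℚ.+ prob e v
prob-++ []            e v = sym (ℚ.+-identityˡ _)
prob-++ ((w , p) ∷ d) e v with ≡-dec _≟_ w v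
... | yes _ = trans (cong (p ℚ.+_) (prob-++ d e v)) (sym (ℚ.+-assoc p _ _))
... | no  _ = prob-++ d e v

mass-++ : ∀ {A : Set} (d e : Dist A) → mass (d ++ e) ≡ mass d ℚ.+ mass e
mass-++ []            e = sym (ℚ.+-identityˡ _)
mass-++ ((w , p) ∷ d) e = trans (cong (p ℚ.+_) (mass-++ d e)) (sym (ℚ.+-assoc p _ _))

prob-scaled : ∀ p (h : List ℕ × ℚ → List ℕ × ℚ) → Scales p h → ∀ e v → prob (map h e) v ≡ p ℚ.* prob e v
prob-scaled p h h-scales []            v = sym (ℚ.*-zeroʳ p)
prob-scaled p h h-scales ((w , q) ∷ e) v rewrite h-scales w q with ≡-dec _≟_ w v
... | yes _ = trans (cong (p ℚ.* q ℚ.+_) (prob-scaled p h h-scales e v)) (sym (ℚ.*-distribˡ-+ p q _))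
... | no  _ = prob-scaled p h h-scales e v

mass-scaled : ∀ {B : Set} p (h : B × ℚ → B × ℚ) → Scales p h → ∀ e → mass (map h e) ≡ p ℚ.* mass e
mass-scaled p h h-scales []            = sym (ℚ.*-zeroʳ p)
mass-scaled p h h-scales ((w , q) ∷ e) rewrite h-scales w q =
  trans (cong (p ℚ.* q ℚ.+_) (mass-scaled p h h-scales e)) (sym (ℚ.*-distribˡ-+ p q _))

prob->>= : ∀ {A : Set} (d : Dist A) (f : A → Dist (List ℕ)) v → prob (d >>= f) v ≡ expect d (λ a → prob (f a) v)
prob->>= []            f v = refl
prob->>= ((a , p) ∷ d) f v =
  trans (prob-++ (map _ (f a)) _ v) (cong₂ ℚ._+_ (prob-scaled p _ (λ _ _ → refl) (f a) v) (prob->>= d f v))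

mass->>= : ∀ {A B : Set} (d : Dist A) (f : A → Dist B) → mass (d >>= f) ≡ expect d (λ a → mass (f a))
mass->>= []            f = refl
mass->>= ((a , p) ∷ d) f =
  trans (mass-++ (map _ (f a)) _) (cong₂ ℚ._+_ (mass-scaled p _ (λ _ _ → refl) (f a)) (mass->>= d f))

mass->>=-1 : ∀ {A B : Set} (d : Dist A) (f : A → Dist B) → (∀ a → mass (f a) ≡ 1ℚ) → mass (d >>= f) ≡ mass d
mass->>=-1 d f mass≡1 = trans (mass->>= d f) (trans (expect-cong d mass≡1) (expect-1 d))

prob-return : ∀ w → prob (return w) w ≡ 1ℚ
prob-return w with ≡-dec _≟_ w w
... | yes _   = ℚ.+-identityʳ 1ℚ
... | no  w≢w = contradiction refl w≢w

AllOutcomes : ∀ {A : Set} → (A → Set) → Dist A → Set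
AllOutcomes Q d = All (Q ∘ proj₁) d

allOutcomes-scaled : ∀ {B : Set} {Q : B → Set} p (h : B × ℚ → B × ℚ) → Scales p h →
  ∀ e → AllOutcomes Q e → AllOutcomes Q (map h e)
allOutcomes-scaled         p h h-scales []            []        = []
allOutcomes-scaled {Q = Q} p h h-scales ((b , q) ∷ e) (Qb ∷ Qe) =
  subst (Q ∘ proj₁) (sym (h-scales b q)) Qb ∷ allOutcomes-scaled p h h-scales e Qe

allOutcomes->>= : ∀ {A B : Set} {Q : B → Set} (d : Dist A) {f : A → Dist B} →
  AllOutcomes (λ a → AllOutcomes Q (f a)) d → AllOutcomes Q (d >>= f)
allOutcomes->>= []                []         = []
allOutcomes->>= ((a , p) ∷ d) {f} (Qfa ∷ Qd) =
  All.++⁺ (allOutcomes-scaled p _ (λ _ _ → refl) (f a) Qfa) (allOutcomes->>= d Qd)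

allOutcomes-uniform : ∀ {A : Set} {Q : A → Set} L → (∀ {x} → x ∈ L → Q x) → AllOutcomes Q (uniform L)
allOutcomes-uniform []       Q-L = []
allOutcomes-uniform (x ∷ xs) Q-L = All.map⁺ (All.tabulate Q-L)

prob≡0 : ∀ d v → AllOutcomes (_≢ v) d → prob d v ≡ 0ℚ
prob≡0 []            v []          = refl
prob≡0 ((w , p) ∷ d) v (w≢v ∷ ≢v) with ≡-dec _≟_ w v
... | yes w≡v = contradiction w≡v w≢v
... | no  _   = prob≡0 d v ≢v

-- The Fisher–Yates shuffle

prob-fisherYates-∷ : ∀ k m is A v →
  prob (fisherYates (k + suc m) (k ∷ is) A) v
    ≡ sumℚ (upTo (suc m)) (λ r → 1 /1+ m ℚ.* prob (fisherYates (k + suc m) is (swap k (k + r) A)) v)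
prob-fisherYates-∷ k m is A v = begin
  prob (fisherYates n (k ∷ is) A) v
    ≡⟨ prob->>= (uniform (drop k (upTo n))) (λ r → fisherYates n is (swap k r A)) v ⟩
  expect (uniform (drop k (upTo n))) G
    ≡⟨ cong (λ L → expect (uniform L) G) (drop-upTo k (suc m)) ⟩
  expect (uniform (map (k +_) (upTo (suc m)))) G
    ≡⟨ expect-weighted (λ _ → 1 /1+ length (map (k +_) (applyUpTo suc m))) G (map (k +_) (upTo (suc m))) ⟩
  sumℚ (map (k +_) (upTo (suc m))) (λ r → 1 /1+ length (map (k +_) (applyUpTo suc m)) ℚ.* G r)
    ≡⟨ cong (λ l → sumℚ (map (k +_) (upTo (suc m))) (λ r → 1 /1+ l ℚ.* G r)) length≡m ⟩
  sumℚ (map (k +_) (upTo (suc m))) (λ r → 1 /1+ m ℚ.* G r)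
    ≡⟨ sumℚ-map (k +_) (λ r → 1 /1+ m ℚ.* G r) (upTo (suc m)) ⟩
  sumℚ (upTo (suc m)) (λ r → 1 /1+ m ℚ.* G (k + r)) ∎
  where
  open ≡-Reasoning
  n : ℕ
  n = k + suc m
  G : ℕ → ℚ
  G r = prob (fisherYates n is (swap k r A)) v
  length≡m : length (map (k +_) (applyUpTo suc m)) ≡ m
  length≡m = trans (length-map (k +_) (applyUpTo suc m)) (length-applyUpTo suc m)

mass-uniform : ∀ {A : Set} (x : A) xs → mass (uniform (x ∷ xs)) ≡ 1ℚ
mass-uniform x xs = begin
  mass (uniform (x ∷ xs))                      ≡⟨ mass-weighted (λ _ → 1 /1+ length xs) (x ∷ xs) ⟩
  sumℚ (x ∷ xs) (λ _ → 1 /1+ length xs)        ≡⟨ sumℚ-/1+ (λ _ → 1) (length xs) (x ∷ xs) ⟩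
  sum (map (λ _ → 1) (x ∷ xs)) /1+ length xs   ≡⟨ cong (_/1+ length xs) (sum-map-1 (x ∷ xs)) ⟩
  suc (length xs) /1+ length xs                ≡⟨ 1+b/1+b≡1 (length xs) ⟩
  1ℚ                                           ∎
  where
  open ≡-Reasoning
  sum-map-1 : ∀ {A : Set} (L : List A) → sum (map (λ _ → 1) L) ≡ length L
  sum-map-1 []      = refl
  sum-map-1 (_ ∷ L) = cong suc (sum-map-1 L)

mass-uniform-drop-upTo : ∀ {i n} → i < n → mass (uniform (drop i (upTo n))) ≡ 1ℚ
mass-uniform-drop-upTo {i} i<n with m≤n⇒∃[o]m+o≡n i<n
... | o , refl = begin
  mass (uniform (drop i (upTo (suc i + o))))  ≡⟨ cong (λ n → mass (uniform (drop i (upTo n)))) (+-suc i o) ⟨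
  mass (uniform (drop i (upTo (i + suc o))))  ≡⟨ cong (mass ∘ uniform) (drop-upTo i (suc o)) ⟩
  mass (uniform (map (i +_) (upTo (suc o))))  ≡⟨ mass-uniform (i + 0) (map (i +_) (applyUpTo suc o)) ⟩
  1ℚ                                          ∎
  where open ≡-Reasoning

fisherYates-mass : ∀ n is A → All (_< n) is → mass (fisherYates n is A) ≡ 1ℚ
fisherYates-mass n []       A []           = ℚ.+-identityʳ 1ℚ
fisherYates-mass n (i ∷ is) A (i<n ∷ is<n) =
  trans (mass->>=-1 (uniform (drop i (upTo n))) _ (λ r → fisherYates-mass n is (swap i r A) is<n))
        (mass-uniform-drop-upTo i<n)

fisherYates-prefix : ∀ n is P S → All (length P ≤_) is →
  AllOutcomes (λ w → ∃ λ W → w ≡ P ++ W) (fisherYates n is (P ++ S))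
fisherYates-prefix n []       P S []             = (S , refl) ∷ []
fisherYates-prefix n (i ∷ is) P S (P≤i ∷ P≤is) =
  allOutcomes->>= (uniform (drop i (upTo n)))
    (allOutcomes-uniform (drop i (upTo n)) λ r∈ → keeps-prefix (proj₁ (∈-drop-upTo i n r∈)))
  where
  keeps-prefix : ∀ {r} → i ≤ r → AllOutcomes (λ w → ∃ λ W → w ≡ P ++ W) (fisherYates n is (swap i r (P ++ S)))
  keeps-prefix i≤r rewrite swap-++-≥ P S P≤i (≤-trans P≤i i≤r) = fisherYates-prefix n is P _ P≤is

fisherYates-~ : ∀ n is A → length A ≡ n → All (_< n) is →
  AllOutcomes (λ w → length w ≡ n × w ~ A) (fisherYates n is A)
fisherYates-~ n []       A |A|≡n []           = (|A|≡n , λ _ → refl) ∷ []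
fisherYates-~ n (i ∷ is) A |A|≡n (i<n ∷ is<n) =
  allOutcomes->>= (uniform (drop i (upTo n))) (allOutcomes-uniform (drop i (upTo n)) λ {r} r∈ →
    All.map (λ {e} → swap-back (proj₂ (∈-drop-upTo i n r∈)) (proj₁ e))
            (fisherYates-~ n is (swap i r A) (trans (length-swap i r A) |A|≡n) is<n))
  where
  <|A| : ∀ {r} → r < n → r < length A
  <|A| r<n = subst (_ <_) (sym |A|≡n) r<n
  swap-back : ∀ {r} → r < n → ∀ w → length w ≡ n × w ~ swap i r A → length w ≡ n × w ~ A
  swap-back {r} r<n w (|w|≡n , w~) = |w|≡n , λ x → trans (w~ x) (swap-~ i r A (<|A| i<n) (<|A| r<n) x)

fisherYates-miss : ∀ n is P {y t} R T → y ≢ t → All (length (P ++ [ y ]) ≤_) is →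
  prob (fisherYates n is ((P ++ [ y ]) ++ R)) (P ++ t ∷ T) ≡ 0ℚ
fisherYates-miss n is P {y} {t} R T y≢t bounds =
  prob≡0 _ _ (All.map ≢target (fisherYates-prefix n is (P ++ [ y ]) R bounds))
  where
  ≢target : ∀ {w} → ∃ (λ W → w ≡ (P ++ [ y ]) ++ W) → w ≢ P ++ t ∷ T
  ≢target (W , refl) eq = y≢t (∷-injectiveˡ (++-cancelˡ P _ _ (trans (sym (++-assoc P [ y ] W)) eq)))

occ-*-! : ∀ {t S} → t ∈ S → UniquePositives S → occ t S * (occ 0 S ∸ δ 0 t) ! ≡ occ 0 S !
occ-*-! {zero} {S} 0∈S _ with occ 0 S | ∈⇒0<occ 0∈S
... | suc _ | _ = refl
occ-*-! {suc u} {S} t∈S uS rewrite occ≡1 uS (s≤s z≤n) t∈S = +-identityʳ _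

sum-map-δ-* : ∀ t c L → sum (map (λ x → δ t x * c) L) ≡ occ t L * c
sum-map-δ-* t c []      = refl
sum-map-δ-* t c (x ∷ L) =
  trans (cong (δ t x * c +_) (sum-map-δ-* t c L)) (sym (*-distribʳ-+ c (δ t x) (occ t L)))

sum-δ-at : ∀ t c S → sum (map (λ r → δ t (at S r) * c) (upTo (length S))) ≡ occ t S * c
sum-δ-at t c S = begin
  sum (map ((λ x → δ t x * c) ∘ at S) (upTo (length S)))      ≡⟨ cong sum (map-∘ (upTo (length S))) ⟩
  sum (map (λ x → δ t x * c) (map (at S) (upTo (length S))))  ≡⟨ cong (sum ∘ map (λ x → δ t x * c)) at-S ⟩
  sum (map (λ x → δ t x * c) S)                               ≡⟨ sum-map-δ-* t c S ⟩
  occ t S * c                                                 ∎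
  where
  open ≡-Reasoning
  at-S : map (at S) (upTo (length S)) ≡ S
  at-S = trans (map-upTo (at S) (length S)) (applyUpTo-at S)

FisherYatesProb : ℕ → Set
FisherYatesProb j = ∀ {k n} P {S T} → length P ≡ k → k + suc j ≡ n →
  length S ≡ suc j → length T ≡ suc j → S ~ T → UniquePositives S →
  ∀ D → suc D ≡ suc j ! → prob (fisherYates n (range k j) (P ++ S)) (P ++ T) ≡ occ 0 S ! /1+ D

fisherYates-prob-0 : FisherYatesProb 0
fisherYates-prob-0 P {[]}        _ _ () _ _ _ _ _
fisherYates-prob-0 P {_ ∷ _ ∷ _} _ _ () _ _ _ _ _
fisherYates-prob-0 P {_ ∷ []} {[]}        _ _ _ () _ _ _ _
fisherYates-prob-0 P {_ ∷ []} {_ ∷ _ ∷ _} _ _ _ () _ _ _ _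
fisherYates-prob-0 P {s ∷ []} {t ∷ []} _ _ _ _ s~t _ .0 refl with ∈-~ {A = [ s ]} [ t ] s~t (here refl)
... | here refl = trans (prob-return (P ++ [ s ])) (cong (_/1+ 0) (sym (occ-0-[s]!≡1 s)))
  where
  occ-0-[s]!≡1 : ∀ s → occ 0 [ s ] ! ≡ 1
  occ-0-[s]!≡1 zero    = refl
  occ-0-[s]!≡1 (suc _) = refl

-- The first swap brings y to the front of the unshuffled part; the rest of the shuffle never
-- moves it again, so only y = t can contribute.
fisherYates-placed : ∀ j → FisherYatesProb j → ∀ P {y R t T A} →
  length R ≡ suc j → length T ≡ suc j → y ∷ R ~ A → A ~ t ∷ T → UniquePositives A →
  ∀ D → suc D ≡ suc (suc j) ! →
  1 /1+ suc j ℚ.* prob (fisherYates (length P + suc (suc j)) (range (suc (length P)) j) ((P ++ [ y ]) ++ R)) (P ++ t ∷ T)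
    ≡ (δ t y * (occ 0 A ∸ δ 0 t) !) /1+ D
fisherYates-placed j ih P {y} {R} {t} {T} {A} |R| |T| yR~A A~tT uA D hD with y ≟ t
... | no y≢t = trans (*-≡0ʳ (1 /1+ suc j) (fisherYates-miss (length P + suc (suc j)) _ P R T y≢t ≥P++[y]))
                     (sym (trans (cong (λ d → (d * (occ 0 A ∸ δ 0 t) !) /1+ D) (δ-≢ (y≢t ∘ sym))) (0/1+b≡0 D)))
  where
  ≥P++[y] : All (length (P ++ [ y ]) ≤_) (range (suc (length P)) j)
  ≥P++[y] = subst (λ m → All (m ≤_) (range (suc (length P)) j)) (sym (length-++-[] P)) (range-≥ (suc (length P)) j)
... | yes refl = begin
  1 /1+ suc j ℚ.* prob (fisherYates n is ((P ++ [ t ]) ++ R)) (P ++ t ∷ T)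
    ≡⟨ cong (λ w → 1 /1+ suc j ℚ.* prob (fisherYates n is ((P ++ [ t ]) ++ R)) w) (++-assoc P [ t ] T) ⟨
  1 /1+ suc j ℚ.* prob (fisherYates n is ((P ++ [ t ]) ++ R)) ((P ++ [ t ]) ++ T)
    ≡⟨ cong (1 /1+ suc j ℚ.*_) (ih (P ++ [ t ]) {R} {T} (length-++-[] P) (sym (+-suc (length P) (suc j)))
                                  |R| |T| R~T uR D′ hD′) ⟩
  1 /1+ suc j ℚ.* occ 0 R ! /1+ D′
    ≡⟨ 1/1+-*-/1+ (suc j) (occ 0 R !) (trans hD (cong (suc (suc j) *_) (sym hD′))) ⟩
  occ 0 R ! /1+ D                         ≡⟨ cong (λ a → (a !) /1+ D) occ-0-R ⟩
  c /1+ D                                 ≡⟨ cong (_/1+ D) (*-identityˡ c) ⟨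
  (1 * c) /1+ D                           ≡⟨ cong (λ d → (d * c) /1+ D) (δ-refl t) ⟨
  (δ t t * c) /1+ D                       ∎
  where
  open ≡-Reasoning
  n c D′ : ℕ
  n = length P + suc (suc j)
  c = (occ 0 A ∸ δ 0 t) !
  D′ = pred (suc j !)
  is : List ℕ
  is = range (suc (length P)) j
  hD′ : suc D′ ≡ suc j !
  hD′ = suc-pred (suc j !) {{suc j !≢0}}
  R~T : R ~ T
  R~T = ~-∷-cancel {t} {R} {T} λ x → trans (yR~A x) (A~tT x)
  uR : UniquePositives R
  uR = uniquePositives-∷⁻ {t} {R} (uniquePositives-~ {t ∷ R} {A} yR~A uA)
  occ-0-R : occ 0 R ≡ occ 0 A ∸ δ 0 t
  occ-0-R = sym (trans (cong (_∸ δ 0 t) (sym (yR~A 0))) (m+n∸m≡n (δ 0 t) (occ 0 R)))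

fisherYates-prob-suc : ∀ j → FisherYatesProb j → FisherYatesProb (suc j)
fisherYates-prob-suc j ih P {[]}            _ _ () _ _ _ _ _
fisherYates-prob-suc j ih P {_ ∷ _} {[]}    _ _ _ () _ _ _ _
fisherYates-prob-suc j ih P {s ∷ S} {t ∷ T} refl refl |sS| |tT| sS~tT uS D hD = begin
  prob (fisherYates n (range k (suc j)) (P ++ s ∷ S)) (P ++ t ∷ T)
    ≡⟨ prob-fisherYates-∷ k (suc j) (range (suc k) j) (P ++ s ∷ S) (P ++ t ∷ T) ⟩
  sumℚ (upTo (suc (suc j))) (λ r → 1 /1+ suc j ℚ.* G (swap k (k + r) (P ++ s ∷ S)))
    ≡⟨ sumℚ-cong (upTo (suc (suc j))) (All.tabulate (λ r∈ → position (∈-upTo⁻ r∈))) ⟩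
  sumℚ (upTo (suc (suc j))) (λ r → (f r * c) /1+ D)
    ≡⟨ sumℚ-/1+ (λ r → f r * c) D (upTo (suc (suc j))) ⟩
  sum (map (λ r → f r * c) (upTo (suc (suc j)))) /1+ D
    ≡⟨ cong (λ m → sum (map (λ r → f r * c) (upTo m)) /1+ D) |sS| ⟨
  sum (map (λ r → f r * c) (upTo (length (s ∷ S)))) /1+ D
    ≡⟨ cong (_/1+ D) (trans (sum-δ-at t c (s ∷ S)) (occ-*-! t∈sS uS)) ⟩
  occ 0 (s ∷ S) ! /1+ D ∎
  where
  open ≡-Reasoning
  k n : ℕ
  k = length P
  n = k + suc (suc j)
  G : List ℕ → ℚ
  G A = prob (fisherYates n (range (suc k) j) A) (P ++ t ∷ T)
  f : ℕ → ℕ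
  f r = δ t (at (s ∷ S) r)
  c : ℕ
  c = (occ 0 (s ∷ S) ∸ δ 0 t) !
  t∈sS : t ∈ s ∷ S
  t∈sS = ∈-~ {A = t ∷ T} (s ∷ S) (λ x → sym (sS~tT x)) (here refl)
  position : ∀ {r} → r < suc (suc j) → 1 /1+ suc j ℚ.* G (swap k (k + r) (P ++ s ∷ S)) ≡ (f r * c) /1+ D
  position {r} r< with swap-into-prefix P r s S (subst (r <_) (sym |sS|) r<)
  ... | R , swapped , |R| , yR~sS = trans (cong (λ A → 1 /1+ suc j ℚ.* G A) swapped)
    (fisherYates-placed j ih P {at (s ∷ S) r} {R} {t} {T} {s ∷ S}
       (suc-injective (trans (cong suc |R|) |sS|)) (suc-injective |tT|) yR~sS sS~tT uS D hD)

fisherYates-prob : ∀ j → FisherYatesProb j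
fisherYates-prob zero    = fisherYates-prob-0
fisherYates-prob (suc j) = fisherYates-prob-suc j (fisherYates-prob j)

-- Variations

InjectiveOnPositives : List ℕ → Set
InjectiveOnPositives v = ∀ (a b : Fin (length v)) → lookup v a ≡ lookup v b → 0 < lookup v a → a ≡ b

DownClosed : List ℕ → Set
DownClosed v = ∀ (i j : ℕ) → 0 < i → i < j → j ∈ v → i ∈ v

repeated-∉ : ∀ {y v} → UniquePositives (y ∷ v) → 0 < y → y ∉ v
repeated-∉ {y} {v} u 0<y y∈v =
  <⇒≱ (subst (λ d → 1 < d + occ y v) (sym (δ-refl y)) (s≤s (∈⇒0<occ y∈v))) (u y 0<y)

uniquePositives⇒injective : ∀ v → UniquePositives v → InjectiveOnPositives v
uniquePositives⇒injective (y ∷ v) u Fin.zero    Fin.zero    _     _    = refl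
uniquePositives⇒injective (y ∷ v) u Fin.zero    (Fin.suc b) y≡vb  0<y  =
  contradiction (subst (_∈ v) (sym y≡vb) (∈-lookup b)) (repeated-∉ u 0<y)
uniquePositives⇒injective (y ∷ v) u (Fin.suc a) Fin.zero    va≡y  0<va =
  contradiction (subst (_∈ v) va≡y (∈-lookup a)) (repeated-∉ u (subst (0 <_) va≡y 0<va))
uniquePositives⇒injective (y ∷ v) u (Fin.suc a) (Fin.suc b) va≡vb 0<va =
  cong Fin.suc (uniquePositives⇒injective v (uniquePositives-∷⁻ {y} {v} u) a b va≡vb 0<va)

injective⇒uniquePositives : ∀ v → InjectiveOnPositives v → UniquePositives v
injective⇒uniquePositives []      _   x _   = z≤n
injective⇒uniquePositives (y ∷ v) inj x 0<x with x ≟ y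
... | yes refl = s≤s (≤-reflexive (∉⇒occ≡0 v x∉v))
  where
  x∉v : x ∉ v
  x∉v x∈v with inj Fin.zero (Fin.suc (Any.index x∈v)) (lookup-index x∈v) 0<x
  ... | ()
... | no  _    = injective⇒uniquePositives v (λ a b eq pos → Fin.suc-injective (inj (Fin.suc a) (Fin.suc b) eq pos)) x 0<x

occ-0-initial : ∀ n p → occ 0 (initial n p) ≡ p
occ-0-initial n p = begin
  occ 0 (replicate p 0 ++ map suc (upTo (n ∸ p)))              ≡⟨ occ-++ 0 (replicate p 0) _ ⟩
  occ 0 (replicate p 0) + occ 0 (map suc (upTo (n ∸ p)))       ≡⟨ cong₂ _+_ (occ-0-replicate p) (occ-0-map-suc (upTo (n ∸ p))) ⟩
  p + 0                                                         ≡⟨ +-identityʳ p ⟩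
  p                                                             ∎
  where open ≡-Reasoning

occ-suc-initial : ∀ n p y → occ (suc y) (initial n p) ≡ occ y (upTo (n ∸ p))
occ-suc-initial n p y = trans (occ-++ (suc y) (replicate p 0) _)
  (cong₂ _+_ (occ-suc-replicate y p) (occ-suc-map-suc y (upTo (n ∸ p))))

length-initial : ∀ n p → p ≤ n → length (initial n p) ≡ n
length-initial n p p≤n = begin
  length (replicate p 0 ++ map suc (upTo (n ∸ p)))   ≡⟨ length-++ (replicate p 0) ⟩
  length (replicate p 0) + length (map suc (upTo (n ∸ p)))
    ≡⟨ cong₂ _+_ (length-replicate p) (trans (length-map suc (upTo (n ∸ p))) (length-applyUpTo _ (n ∸ p))) ⟩
  p + (n ∸ p)                                          ≡⟨ m+[n∸m]≡n p≤n ⟩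
  n                                                    ∎
  where open ≡-Reasoning

uniquePositives-initial : ∀ n p → UniquePositives (initial n p)
uniquePositives-initial n p (suc y) _ =
  subst (_≤ 1) (sym (occ-suc-initial n p y)) (occ-upTo≤1 y (n ∸ p))

0<occ-upTo⇒< : ∀ {y} m → 0 < occ y (upTo m) → y < m
0<occ-upTo⇒< m = ∈-upTo⁻ ∘ 0<occ⇒∈ (upTo m)

~initial⇒variation : ∀ n p w → length w ≡ n → w ~ initial n p → IsVariation n w
~initial⇒variation n p w |w|≡n w~ =
  |w|≡n , uniquePositives⇒injective w (uniquePositives-~ {w} {initial n p} w~ (uniquePositives-initial n p)) , downClosed
  where
  downClosed : DownClosed w
  downClosed (suc i) (suc j) _ (s≤s i<j) j+1∈w = 0<occ⇒∈ w (subst (0 <_) (sym occ-i+1≡1) (s≤s z≤n))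
    where
    j< : j < n ∸ p
    j< = 0<occ-upTo⇒< (n ∸ p) (subst (0 <_) (trans (w~ (suc j)) (occ-suc-initial n p j)) (∈⇒0<occ j+1∈w))
    occ-i+1≡1 : occ (suc i) w ≡ 1
    occ-i+1≡1 = trans (w~ (suc i)) (trans (occ-suc-initial n p i) (occ-upTo-< (<-trans i<j j<)))

erase : ℕ → List ℕ → List ℕ
erase x []      = []
erase x (y ∷ L) with x ≟ y
... | yes _ = erase x L
... | no  _ = y ∷ erase x L

length-erase : ∀ x L → length L ≡ occ x L + length (erase x L)
length-erase x []      = refl
length-erase x (y ∷ L) with x ≟ y
... | yes _ = cong suc (length-erase x L)
... | no  _ = trans (cong suc (length-erase x L)) (sym (+-suc (occ x L) _))

occ-erase-≢ : ∀ w x L → w ≢ x → occ w (erase x L) ≡ occ w L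
occ-erase-≢ w x []      _   = refl
occ-erase-≢ w x (y ∷ L) w≢x with x ≟ y
... | yes refl = trans (occ-erase-≢ w x L w≢x) (cong (_+ occ w L) (sym (δ-≢ w≢x)))
... | no  _    = cong (δ w y +_) (occ-erase-≢ w x L w≢x)

occ-erase-≤ : ∀ w x L → occ w (erase x L) ≤ occ w L
occ-erase-≤ w x []      = z≤n
occ-erase-≤ w x (y ∷ L) with x ≟ y
... | yes _ = ≤-trans (occ-erase-≤ w x L) (m≤n+m _ (δ w y))
... | no  _ = +-monoʳ-≤ (δ w y) (occ-erase-≤ w x L)

erase-bound : ∀ y L → All (_≤ suc y) L → All (_≤ y) (erase (suc y) L)
erase-bound y []      []             = []
erase-bound y (x ∷ L) (x≤y+1 ∷ L≤y+1) with suc y ≟ x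
... | yes _    = erase-bound y L L≤y+1
... | no  y+1≢x = ≤-pred (≤∧≢⇒< x≤y+1 (y+1≢x ∘ sym)) ∷ erase-bound y L L≤y+1

length≤occ-0+bound : ∀ y L → All (_≤ y) L → UniquePositives L → length L ≤ occ 0 L + y
length≤occ-0+bound zero    L L≤0 _ = ≤-reflexive (trans (all-zero L L≤0) (sym (+-identityʳ _)))
  where
  all-zero : ∀ L → All (_≤ 0) L → length L ≡ occ 0 L
  all-zero []      []          = refl
  all-zero (_ ∷ L) (z≤n ∷ L≤0) = cong suc (all-zero L L≤0)
length≤occ-0+bound (suc y) L L≤y+1 uL = begin
  length L                                       ≡⟨ length-erase (suc y) L ⟩
  occ (suc y) L + length (erase (suc y) L)       ≤⟨ +-mono-≤ (uL (suc y) (s≤s z≤n)) rest ⟩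
  1 + (occ 0 (erase (suc y) L) + y)              ≡⟨ cong (λ z → 1 + (z + y)) (occ-erase-≢ 0 (suc y) L λ ()) ⟩
  1 + (occ 0 L + y)                              ≡⟨ +-suc (occ 0 L) y ⟨
  occ 0 L + suc y                                ∎
  where
  open ≤-Reasoning
  rest : length (erase (suc y) L) ≤ occ 0 (erase (suc y) L) + y
  rest = length≤occ-0+bound y (erase (suc y) L) (erase-bound y L L≤y+1)
           (λ x 0<x → ≤-trans (occ-erase-≤ x (suc y) L) (uL x 0<x))

occ-0+bound≤length : ∀ x L → (∀ i → 0 < i → i ≤ x → i ∈ L) → occ 0 L + x ≤ length L
occ-0+bound≤length zero    L _        = ≤-trans (≤-reflexive (+-identityʳ _)) (occ≤length 0 L)
occ-0+bound≤length (suc x) L [1,x+1]⊆L = begin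
  occ 0 L + suc x                                ≡⟨ +-suc (occ 0 L) x ⟩
  1 + (occ 0 L + x)                              ≡⟨ cong (λ z → 1 + (z + x)) (occ-erase-≢ 0 (suc x) L λ ()) ⟨
  1 + (occ 0 (erase (suc x) L) + x)              ≤⟨ +-mono-≤ (∈⇒0<occ ([1,x+1]⊆L (suc x) (s≤s z≤n) ≤-refl)) rest ⟩
  occ (suc x) L + length (erase (suc x) L)       ≡⟨ length-erase (suc x) L ⟨
  length L                                       ∎
  where
  open ≤-Reasoning
  rest : occ 0 (erase (suc x) L) + x ≤ length (erase (suc x) L)
  rest = occ-0+bound≤length x (erase (suc x) L) λ i 0<i i≤x →
    0<occ⇒∈ (erase (suc x) L) (subst (0 <_) (sym (occ-erase-≢ i (suc x) L (<⇒≢ (s≤s i≤x))))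
                                       (∈⇒0<occ ([1,x+1]⊆L i 0<i (m≤n⇒m≤1+n i≤x))))

variation-∈⇒< : ∀ {n v y} → IsVariation n v → suc y ∈ v → y < n ∸ occ 0 v
variation-∈⇒< {n} {v} {y} (|v|≡n , _ , down) y+1∈v =
  m+n≤o⇒m≤o∸n (suc y) (subst (_≤ n) (+-comm (occ 0 v) (suc y))
    (subst (occ 0 v + suc y ≤_) |v|≡n (occ-0+bound≤length (suc y) v [1,y+1]⊆v)))
  where
  [1,y+1]⊆v : ∀ i → 0 < i → i ≤ suc y → i ∈ v
  [1,y+1]⊆v i 0<i i≤y+1 with i ≟ suc y
  ... | yes refl  = y+1∈v
  ... | no  i≢y+1 = down i (suc y) 0<i (≤∧≢⇒< i≤y+1 i≢y+1) y+1∈v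

variation-<⇒∈ : ∀ {n v y} → IsVariation n v → y < n ∸ occ 0 v → suc y ∈ v
variation-<⇒∈ {n} {v} {y} (|v|≡n , inj , down) y< with suc y ∈? v
... | yes y+1∈v = y+1∈v
... | no  y+1∉v =
  contradiction (≤-trans (∸-monoˡ-≤ (occ 0 v) n≤z+y) (≤-reflexive (m+n∸m≡n (occ 0 v) y))) (<⇒≱ y<)
  where
  bounded : ∀ {e} → e ∈ v → e ≤ y
  bounded {e} e∈v with e ≤? y
  ... | yes e≤y = e≤y
  ... | no  e≰y with e ≟ suc y
  ...   | yes refl  = contradiction e∈v y+1∉v
  ...   | no  e≢y+1 =
    contradiction (down (suc y) e (s≤s z≤n) (≤∧≢⇒< (≰⇒> e≰y) (e≢y+1 ∘ sym)) e∈v) y+1∉v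
  n≤z+y : n ≤ occ 0 v + y
  n≤z+y = subst (_≤ occ 0 v + y) |v|≡n
    (length≤occ-0+bound y v (All.tabulate bounded) (injective⇒uniquePositives v inj))

variation⇒~initial : ∀ {n v} → IsVariation n v → v ~ initial n (occ 0 v)
variation⇒~initial {n} {v} var zero    = sym (occ-0-initial n (occ 0 v))
variation⇒~initial {n} {v} var@(_ , inj , _) (suc y) = trans occ-v (sym (occ-suc-initial n (occ 0 v) y))
  where
  occ-v : occ (suc y) v ≡ occ y (upTo (n ∸ occ 0 v))
  occ-v with y <? n ∸ occ 0 v
  ... | yes y< = trans (occ≡1 (injective⇒uniquePositives v inj) (s≤s z≤n) (variation-<⇒∈ var y<))
                       (sym (occ-upTo-< y<))
  ... | no  y≮ = trans (∉⇒occ≡0 v (y≮ ∘ variation-∈⇒< var)) (sym (occ-upTo-≥ (≮⇒≥ y≮)))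

-- The procedure

shuffledInitial : ℕ → ℕ → Dist (List ℕ)
shuffledInitial n p = fisherYates n (upTo (n ∸ 1)) (initial n p)

weightSum : ℕ → ℕ
weightSum n = sum (map (weight n) (upTo n))

weight-*-! : ∀ {n p} → p ≤ n → weight n p * p ! ≡ n !
weight-*-! {n} {p} p≤n = m/n*n≡m {{p !≢0}} (m≤n⇒m!∣n! p≤n)

sum-weights : ∀ n → sum (map (weight n) (upTo (suc n))) ≡ suc (weightSum n)
sum-weights n = begin
  sum (map (weight n) (upTo (suc n)))            ≡⟨ cong (sum ∘ map (weight n)) (upTo-∷ʳ n) ⟨
  sum (map (weight n) (upTo n ++ [ n ]))         ≡⟨ cong sum (map-++ (weight n) (upTo n) [ n ]) ⟩
  sum (map (weight n) (upTo n) ++ [ weight n n ]) ≡⟨ sum-++ (map (weight n) (upTo n)) [ weight n n ] ⟩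
  weightSum n + (weight n n + 0)                 ≡⟨ cong (λ w → weightSum n + (w + 0)) (n/n≡1 (n !) {{n !≢0}}) ⟩
  weightSum n + 1                                ≡⟨ +-comm (weightSum n) 1 ⟩
  suc (weightSum n)                              ∎
  where open ≡-Reasoning

prob-procedure : ∀ n v →
  prob (procedure n) v ≡ sumℚ (upTo (suc n)) (λ p → weight n p /1+ weightSum n ℚ.* prob (shuffledInitial n p) v)
prob-procedure n v = trans (prob->>= (poissonTrunc n) (shuffledInitial n) v)
  (expect-weighted (λ p → weight n p /1+ weightSum n) (λ p → prob (shuffledInitial n p) v) (upTo (suc n)))

upTo-pred-< : ∀ n → All (_< n) (upTo (n ∸ 1))
upTo-pred-< n = All.tabulate λ r∈ → <-≤-trans (∈-upTo⁻ r∈) (m∸n≤m n 1)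

shuffledInitial-~ : ∀ {n p} → p ≤ n → AllOutcomes (λ w → length w ≡ n × w ~ initial n p) (shuffledInitial n p)
shuffledInitial-~ {n} {p} p≤n = fisherYates-~ n (upTo (n ∸ 1)) (initial n p) (length-initial n p p≤n) (upTo-pred-< n)

procedure-mass : ∀ n → mass (procedure n) ≡ 1ℚ
procedure-mass n = begin
  mass (procedure n)
    ≡⟨ mass->>=-1 (poissonTrunc n) (shuffledInitial n) (λ p → fisherYates-mass n _ (initial n p) (upTo-pred-< n)) ⟩
  mass (poissonTrunc n)
    ≡⟨ mass-weighted (λ p → weight n p /1+ weightSum n) (upTo (suc n)) ⟩
  sumℚ (upTo (suc n)) (λ p → weight n p /1+ weightSum n)
    ≡⟨ sumℚ-/1+ (weight n) (weightSum n) (upTo (suc n)) ⟩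
  sum (map (weight n) (upTo (suc n))) /1+ weightSum n
    ≡⟨ cong (_/1+ weightSum n) (sum-weights n) ⟩
  suc (weightSum n) /1+ weightSum n
    ≡⟨ 1+b/1+b≡1 (weightSum n) ⟩
  1ℚ ∎
  where open ≡-Reasoning

procedure-nonvariation : ∀ n v → ¬ IsVariation n v → prob (procedure n) v ≡ 0ℚ
procedure-nonvariation n v ¬var = trans (prob-procedure n v) (sumℚ-0 (upTo (suc n)) (All.tabulate λ {p} p∈ →
  *-≡0ʳ (weight n p /1+ weightSum n) (prob≡0 _ v (All.map (≢v p) (shuffledInitial-~ (≤-pred (∈-upTo⁻ p∈)))))))
  where
  ≢v : ∀ p {w} → length w ≡ n × w ~ initial n p → w ≢ v
  ≢v p {w} (|w|≡n , w~) refl = ¬var (~initial⇒variation n p w |w|≡n w~)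

procedure-variation : ∀ n v → IsVariation (suc n) v → prob (procedure (suc n)) v ≡ 1 /1+ weightSum (suc n)
procedure-variation n v var@(|v|≡N , _) = begin
  prob (procedure N) v
    ≡⟨ prob-procedure N v ⟩
  sumℚ (upTo (suc N)) (λ p → weight N p /1+ weightSum N ℚ.* prob (shuffledInitial N p) v)
    ≡⟨ sumℚ-single (upTo (suc N)) (occ-upTo-< (s≤s z≤N)) (All.tabulate λ {p} p∈ p≢z →
         *-≡0ʳ (weight N p /1+ weightSum N)
               (prob≡0 _ v (All.map (≢v p≢z) (shuffledInitial-~ (≤-pred (∈-upTo⁻ p∈)))))) ⟩
  weight N z /1+ weightSum N ℚ.* prob (shuffledInitial N z) v
    ≡⟨ cong (λ is → weight N z /1+ weightSum N ℚ.* prob (fisherYates N is (initial N z)) v) (upTo≡range n) ⟩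
  weight N z /1+ weightSum N ℚ.* prob (fisherYates N (range 0 n) (initial N z)) v
    ≡⟨ cong (weight N z /1+ weightSum N ℚ.*_) (fisherYates-prob n [] refl refl (length-initial N z z≤N) |v|≡N
          (λ x → sym (variation⇒~initial var x)) (uniquePositives-initial N z) D (suc-pred (N !) {{N !≢0}})) ⟩
  weight N z /1+ weightSum N ℚ.* occ 0 (initial N z) ! /1+ D
    ≡⟨ cong (λ a → weight N z /1+ weightSum N ℚ.* (a !) /1+ D) (occ-0-initial N z) ⟩
  weight N z /1+ weightSum N ℚ.* z ! /1+ D
    ≡⟨ /1+-*-/1+-cancel (weight N z) (weightSum N) (z !) D (trans (weight-*-! z≤N) (sym (suc-pred (N !) {{N !≢0}}))) ⟩
  1 /1+ weightSum N ∎
  where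
  open ≡-Reasoning
  N z D : ℕ
  N = suc n
  z = occ 0 v
  D = pred (N !)
  z≤N : z ≤ N
  z≤N = subst (z ≤_) |v|≡N (occ≤length 0 v)
  ≢v : ∀ {p w} → p ≢ z → length w ≡ N × w ~ initial N p → w ≢ v
  ≢v {p} {w} p≢z (_ , w~) refl = p≢z (trans (sym (occ-0-initial N p)) (sym (w~ 0)))

lemma6p1 : (n : ℕ) → 0 < n →
    (mass (procedure n) ≡ 1ℚ)
    × ((v : List ℕ) → ¬ IsVariation n v → prob (procedure n) v ≡ 0ℚ)
    × ((v w : List ℕ) → IsVariation n v → IsVariation n w →
       prob (procedure n) v ≡ prob (procedure n) w)
lemma6p1 (suc n) _ =
  procedure-mass (suc n) , procedure-nonvariation (suc n) ,
  λ v w v-var w-var → trans (procedure-variation n v v-var) (sym (procedure-variation n w w-var))
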